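{- Let $k\ge0$ and let $\mathcal{M}_k=((W_k,R_k,V_k),\varepsilon)$ be the pointed model described in the context. Let $\sigma,\tau$ be distinct worlds of $\mathcal{M}_k$ of length (tree depth) $n$. Then $(\mathcal{M}_k$-model$,\sigma)$ and $(\mathcal{M}_k$-model$,\tau)$ are $(k-n)$-bisimilar but not $(k-n+1)$-bisimilar, i.e., $\sigma \sim_{k-n} \tau$ and $\sigma\not\sim_{k-n+1}\tau$.
   Context: A model is $M=(W,R,V)$ with $W$ finite nonempty, a relation $R_i\subseteq W\times W$ for each modality index $i$, and $V$ assigning to each atomic proposition a subset of $W$. For $h\ge0$, a $h$-bisimulation between $(M,w)$ and $(M',w')$ is a sequence of nonempty relations $Z_h\subseteq\cdots\subseteq Z_0\subseteq W\times W'$ with $(w,w')\in Z_h$ such that pairs in $Z_0$ satisfy the same atoms, and for all $j<h$: if $(u,u')\in Z_{j+1}$ and $uR_iv$ then some $v'$ has $u'R'_iv'$ and $(v,v')\in Z_j$ (forth), and symmetrically (back). For worlds of one model, $u\sim_h v$ means an $h$-bisimulation between $(M,u)$ and $(M,v)$ exists. The model $\mathcal{M}_k$: modality indices $\{s,d\}$, atomic propositions $\{p_0,\dots,p_k\}$; $W_k=\{\sigma\in\{l,r\}^*\mid|\sigma|\le k\}$ (strings over $\{l,r\}$ of length at most $k$, with empty string $\varepsilon$ the designated world); $(R_k)_s=\{(\sigma,\sigma\alpha)\mid \sigma,\sigma\alpha\in W_k,\ \alpha\in\{l,r\}\}$; $(R_k)_d=\{(\alpha_1\cdots\alpha_k,\,l^n)\mid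 \alpha_1\cdots\alpha_k\in W_k,\ 0\le n<k,\ \alpha_{n+1}=l\}$, where $l^n$ is the string of $n$ letters $l$; $V_k(p_n)=\{\sigma\in W_k\mid|\sigma|=n\}$. -}

module Defs where

open import Data.Nat using (ℕ; zero; suc; _≤_; _<_; _+_; z≤n)
open import Data.Fin using (Fin; toℕ)
open import Data.List using (List; []; _∷_; _++_; [_]; length; replicate)
open import Data.Product using (Σ; ∃; ∃-syntax; _×_; _,_; proj₁)
open import Relation.Binary.PropositionalEquality using (_≡_)

record Model (I P : Set) : Set₁ where
  field
    W : Set
    R : I → W → W → Set
    V : P → W → Set

open Model public

-- h-bisimulation between (M , w) and (M' , w'), exactly as in the context:
-- a sequence Z_0 ⊇ Z_1 ⊇ ... ⊇ Z_h of nonempty relations (Z j for j ≤ h;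
-- values of Z at indices > h are irrelevant), with (w , w') ∈ Z_h.
record HBisim {I P : Set} (h : ℕ) (M M' : Model I P) (w : W M) (w' : W M') : Set₁ where
  field
    Z        : ℕ → W M → W M' → Set
    nonempty : ∀ j → j ≤ h → ∃[ u ] ∃[ u' ] Z j u u'
    nested   : ∀ j → j < h → ∀ u u' → Z (suc j) u u' → Z j u u'
    base     : Z h w w'
    atoms    : ∀ u u' → Z 0 u u' → ∀ p → (V M p u → V M' p u') × (V M' p u' → V M p u)
    forth    : ∀ j → j < h → ∀ i u u' v → Z (suc j) u u' → R M i u v →
               ∃[ v' ] (R M' i u' v' × Z j v v')
    back     : ∀ j → j < h → ∀ i u u' v' → Z (suc j) u u' → R M' i u' v' →
               ∃[ v ] (R M i u v × Z j v v')

_⊢_∼[_]_ : {I P : Set} (M : Model I P) → W M → ℕ → W M → Set₁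
M ⊢ u ∼[ h ] v = HBisim h M M u v

data Mod : Set where
  s d : Mod

data LR : Set where
  l r : LR

Wk : ℕ → Set
Wk k = Σ (List LR) (λ σ → length σ ≤ k)

-- (R_k)_s = {(σ, σα)}
-- (R_k)_d = {(α₁⋯α_k , lⁿ) | 0 ≤ n < k, α_{n+1} = l}  (source of length exactly k)
Rk : (k : ℕ) → Mod → Wk k → Wk k → Set
Rk k s (σ , _) (τ , _) = ∃[ α ] (τ ≡ σ ++ [ α ])
Rk k d (σ , _) (τ , _) =
  length σ ≡ k × ∃[ n ] (n < k × τ ≡ replicate n l ×
    ∃[ ρ ] ∃[ ρ' ] (length ρ ≡ n × σ ≡ ρ ++ (l ∷ ρ')))

Vk : (k : ℕ) → Fin (suc k) → Wk k → Set
Vk k p (σ , _) = length σ ≡ toℕ p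

𝓜 : (k : ℕ) → Model Mod (Fin (suc k))
𝓜 k = record { W = Wk k ; R = Rk k ; V = Vk k }

ε : (k : ℕ) → Wk k
ε k = [] , z≤n

{-# OPTIONS --safe #-}
module Submission where

-- Relating worlds of equal depth n whenever they still have room for j more
-- s-steps (n + j ≤ k) is a (k − n)-bisimulation: s-steps are matched by appending the
-- same letter, and d-steps, which leave only worlds of depth k, never have to be matched.
-- Conversely, if σ and τ differ at position m, say σ has l there and τ has r, then
-- Spoiler appends l to σ for k − n rounds, keeping the difference at position m, and at
-- depth k takes the d-step to l^m. Duplicator must answer with a d-step of the extension
-- of τ landing at depth m (atom p_m), and such a step exists only if that extension has
-- l at position m.

open import Defs
open import Data.Nat using (ℕ; zero; suc; _∸_; _+_; _≤_; _<_; s≤s; z<s)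
open import Data.Nat.Properties
open import Data.Fin using (Fin; fromℕ<)
open import Data.Fin.Properties using (toℕ-fromℕ<)
open import Data.List using (List; []; _∷_; _++_; [_]; length; replicate)
open import Data.List.Properties
  using (length-++; length-replicate; ++-assoc; ∷-injectiveˡ; ∷-injectiveʳ)
open import Data.Product using (_×_; _,_; proj₁; proj₂; swap; ∃-syntax)
open import Data.Empty using (⊥-elim)
open import Relation.Binary.Definitions using (DecidableEquality)
open import Relation.Binary.PropositionalEquality
  using (_≡_; _≢_; refl; sym; trans; cong; subst; module ≡-Reasoning)
open import Relation.Nullary using (¬_; yes; no)

module _ {I P : Set} {M M' : Model I P} where

  HBisim-sym : ∀ {h w w'} → HBisim h M M' w w' → HBisim h M' M w' w
  HBisim-sym B = record
    { Z        = λ j u' u → Z j u u'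
    ; nonempty = λ j j≤h → let u , u' , z = nonempty j j≤h in u' , u , z
    ; nested   = λ j j<h u' u → nested j j<h u u'
    ; base     = base
    ; atoms    = λ u' u z p → swap (atoms u u' z p)
    ; forth    = λ j j<h i u' u → back j j<h i u u'
    ; back     = λ j j<h i u' u → forth j j<h i u u'
    }
    where open HBisim B

  HBisim-forth : ∀ {h w w' i v} → HBisim (suc h) M M' w w' → R M i w v →
                 ∃[ v' ] (R M' i w' v' × HBisim h M M' v v')
  HBisim-forth {h} {w} {w'} {i} {v} B wRv =
    let v' , w'Rv' , z = forth h (n<1+n h) i w w' v base wRv in
    v' , w'Rv' , record
      { Z        = Z
      ; nonempty = λ j j≤h → nonempty j (m≤n⇒m≤1+n j≤h)
      ; nested   = λ j j<h → nested j (m<n⇒m<1+n j<h)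
      ; base     = z
      ; atoms    = atoms
      ; forth    = λ j j<h → forth j (m<n⇒m<1+n j<h)
      ; back     = λ j j<h → back j (m<n⇒m<1+n j<h)
      }
    where open HBisim B

  HBisim-atoms : ∀ {w w'} → HBisim 0 M M' w w' → ∀ p → V M p w → V M' p w'
  HBisim-atoms B p = proj₁ (atoms _ _ base p)
    where open HBisim B

module _ {A : Set} where

  -- xs [ m ]= a: the letter at 0-based position m is a (the paper's α_{m+1} = a), in the
  -- form used by (R_k)_d.
  _[_]=_ : List A → ℕ → A → Set
  xs [ m ]= a = ∃[ ρ ] ∃[ ρ' ] (length ρ ≡ m × xs ≡ ρ ++ a ∷ ρ')

  []=-unique : ∀ {xs m a b} → xs [ m ]= a → xs [ m ]= b → a ≡ b
  []=-unique ([] , _ , refl , refl) ([] , _ , _ , eq) = ∷-injectiveˡ eq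
  []=-unique ([] , _ , refl , _) (_ ∷ _ , _ , () , _)
  []=-unique (_ ∷ _ , _ , refl , _) ([] , _ , () , _)
  []=-unique (_ ∷ ρ , ρ' , refl , refl) (_ ∷ τ , τ' , eq , eq') =
    []=-unique (ρ , ρ' , refl , refl) (τ , τ' , suc-injective eq , ∷-injectiveʳ eq')

  []=-∷ʳ : ∀ {xs m a} b → xs [ m ]= a → (xs ++ [ b ]) [ m ]= a
  []=-∷ʳ {a = a} b (ρ , ρ' , lρ , refl) = ρ , ρ' ++ [ b ] , lρ , ++-assoc ρ (a ∷ ρ') [ b ]

  []=⇒<length : ∀ {xs m a} → xs [ m ]= a → m < length xs
  []=⇒<length {a = a} (ρ , ρ' , refl , refl) =
    subst (length ρ <_) (sym (length-++ ρ {a ∷ ρ'})) (m<m+n (length ρ) z<s)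

  first-difference : DecidableEquality A → ∀ {xs ys} → xs ≢ ys → length xs ≡ length ys →
                     ∃[ m ] ∃[ a ] ∃[ b ] (a ≢ b × xs [ m ]= a × ys [ m ]= b)
  first-difference _≟_ {[]}     {[]}     xs≢ys _ = ⊥-elim (xs≢ys refl)
  first-difference _≟_ {x ∷ xs} {y ∷ ys} xs≢ys eq with x ≟ y
  ... | no x≢y  = 0 , x , y , x≢y , ([] , xs , refl , refl) , ([] , ys , refl , refl)
  ... | yes refl =
    let m , a , b , a≢b , (ρ , ρ' , lρ , eρ) , (τ , τ' , lτ , eτ) =
          first-difference _≟_ (λ xs≡ys → xs≢ys (cong (x ∷_) xs≡ys)) (suc-injective eq)
    in suc m , a , b , a≢b , (x ∷ ρ , ρ' , cong suc lρ , cong (x ∷_) eρ)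
                           , (x ∷ τ , τ' , cong suc lτ , cong (x ∷_) eτ)

_≟ᴸᴿ_ : DecidableEquality LR
l ≟ᴸᴿ l = yes refl
r ≟ᴸᴿ r = yes refl
l ≟ᴸᴿ r = no λ ()
r ≟ᴸᴿ l = no λ ()

length-∷ʳ+ : ∀ {A : Set} (xs : List A) a j → length (xs ++ [ a ]) + j ≡ length xs + suc j
length-∷ʳ+ xs a j = begin
  length (xs ++ [ a ]) + j  ≡⟨ cong (_+ j) (length-++ xs) ⟩
  length xs + 1 + j         ≡⟨ +-assoc (length xs) 1 j ⟩
  length xs + suc j         ∎
  where open ≡-Reasoning

module _ (k : ℕ) where

  depth : Wk k → ℕ
  depth u = length (proj₁ u)

  extend : ∀ j (u : Wk k) → depth u + suc j ≤ k → LR → Wk k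
  extend j (xs , _) room a =
    xs ++ [ a ] , m+n≤o⇒m≤o _ (subst (_≤ k) (sym (length-∷ʳ+ xs a j)) room)

  l^ : ∀ m → m ≤ k → Wk k
  l^ m m≤k = replicate m l , subst (_≤ k) (sym (length-replicate m)) m≤k

  atom : ∀ {m} → m ≤ k → Fin (suc k)
  atom m≤k = fromℕ< (s≤s m≤k)

  EqualDepth : ℕ → Wk k → Wk k → Set
  EqualDepth j u u' = depth u ≡ depth u' × depth u + j ≤ k

  EqualDepth-sym : ∀ {j} u u' → EqualDepth j u u' → EqualDepth j u' u
  EqualDepth-sym {j} _ _ (e , room) = sym e , subst (λ n → n + j ≤ k) e room

  EqualDepth-forth : ∀ j i {u u' v} → EqualDepth (suc j) u u' → Rk k i u v →
                     ∃[ v' ] (Rk k i u' v' × EqualDepth j v v')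
  EqualDepth-forth j s {xs , _} {u'@(ys , _)} (e , room) (α , refl) =
    extend j u' room' α , (α , refl) , e' , subst (_≤ k) (sym (length-∷ʳ+ xs α j)) room
    where
      room' : length ys + suc j ≤ k
      room' = subst (λ n → n + suc j ≤ k) e room
      e' : length (xs ++ [ α ]) ≡ length (ys ++ [ α ])
      e' = trans (length-++ xs) (trans (cong (_+ 1) e) (sym (length-++ ys)))
  EqualDepth-forth j d (_ , room) (depth≡k , _) =
    ⊥-elim (m+1+n≰m k (subst (λ n → n + suc j ≤ k) depth≡k room))

  equalDepth⇒bisimilar : (σ τ : Wk k) → depth σ ≡ depth τ → 𝓜 k ⊢ σ ∼[ k ∸ depth σ ] τ
  equalDepth⇒bisimilar σ τ e = record
    { Z        = EqualDepth
    ; nonempty = λ j j≤h → σ , τ , e , ≤-trans (+-monoʳ-≤ (depth σ) j≤h) (≤-reflexive σ+h≡k)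
    ; nested   = λ j _ u u' (u≡u' , room) → u≡u' , ≤-trans (+-monoʳ-≤ (depth u) (n≤1+n j)) room
    ; base     = e , ≤-reflexive σ+h≡k
    ; atoms    = λ u u' (u≡u' , _) p → trans (sym u≡u') , trans u≡u'
    ; forth    = λ j _ i u u' v → EqualDepth-forth j i {u} {u'} {v}
    ; back     = λ j _ i u u' v' z u'Rv' →
                   let v , uRv , z' = EqualDepth-forth j i {u'} {u} {v'} (EqualDepth-sym u u' z) u'Rv'
                   in v , uRv , EqualDepth-sym v' v z'
    }
    where
      σ+h≡k : depth σ + (k ∸ depth σ) ≡ k
      σ+h≡k = m+[n∸m]≡n (proj₂ σ)

  s-step-keeps-letter : ∀ {m a} u v → Rk k s u v → proj₁ u [ m ]= a → proj₁ v [ m ]= a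
  s-step-keeps-letter _ _ (β , refl) = []=-∷ʳ β

  d-step-letter : ∀ u v → Rk k d u v → proj₁ u [ depth v ]= l
  d-step-letter _ (_ , _) (_ , n , _ , refl , ρ , ρ' , lρ , eq) =
    ρ , ρ' , trans lρ (sym (length-replicate n)) , eq

  l-mismatch⇒¬1-bisimilar : ∀ {m b} (u u' : Wk k) → depth u ≡ k →
                            proj₁ u [ m ]= l → proj₁ u' [ m ]= b → b ≢ l → ¬ (𝓜 k ⊢ u ∼[ 1 ] u')
  l-mismatch⇒¬1-bisimilar {m} u u' depth≡k u[m]=l u'[m]=b b≢l B =
    let v' , u'Rv' , B₀ = HBisim-forth {i = d} {v = l^ m m≤k} B (depth≡k , m , m<k , refl , u[m]=l)
        depth-v'≡m = trans (HBisim-atoms B₀ (atom m≤k) depth-l^m) (toℕ-fromℕ< (s≤s m≤k))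
    in b≢l ([]=-unique u'[m]=b (subst (proj₁ u' [_]= l) depth-v'≡m (d-step-letter u' v' u'Rv')))
    where
      m<k : m < k
      m<k = subst (m <_) depth≡k ([]=⇒<length u[m]=l)
      m≤k : m ≤ k
      m≤k = <⇒≤ m<k
      depth-l^m : Vk k (atom m≤k) (l^ m m≤k)
      depth-l^m = trans (length-replicate m) (sym (toℕ-fromℕ< (s≤s m≤k)))

  l-mismatch⇒¬bisimilar : ∀ t {m b} (u u' : Wk k) → depth u + t ≡ k →
                          proj₁ u [ m ]= l → proj₁ u' [ m ]= b → b ≢ l → ¬ (𝓜 k ⊢ u ∼[ suc t ] u')
  l-mismatch⇒¬bisimilar zero u u' depth≡k =
    l-mismatch⇒¬1-bisimilar u u' (trans (sym (+-identityʳ (depth u))) depth≡k)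
  l-mismatch⇒¬bisimilar (suc t) u@(xs , _) u' depth+t≡k u[m]=l u'[m]=b b≢l B =
    let v = extend t u (≤-reflexive depth+t≡k) l
        v' , u'Rv' , B' = HBisim-forth {i = s} {v = v} B (l , refl)
    in l-mismatch⇒¬bisimilar t v v' (trans (length-∷ʳ+ xs l t) depth+t≡k)
         ([]=-∷ʳ l u[m]=l) (s-step-keeps-letter u' v' u'Rv' u'[m]=b) b≢l B'

  distinct⇒¬bisimilar : ∀ t (σ τ : Wk k) → proj₁ σ ≢ proj₁ τ → depth σ ≡ depth τ →
                        depth σ + t ≡ k → ¬ (𝓜 k ⊢ σ ∼[ suc t ] τ)
  distinct⇒¬bisimilar t σ τ σ≢τ e σ+t≡k B with first-difference _≟ᴸᴿ_ σ≢τ e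
  ... | _ , l , l , l≢l , _ = l≢l refl
  ... | _ , r , r , r≢r , _ = r≢r refl
  ... | _ , l , r , _ , σ[m]=l , τ[m]=r =
    l-mismatch⇒¬bisimilar t σ τ σ+t≡k σ[m]=l τ[m]=r (λ ()) B
  ... | _ , r , l , _ , σ[m]=r , τ[m]=l =
    l-mismatch⇒¬bisimilar t τ σ (subst (λ n → n + t ≡ k) e σ+t≡k) τ[m]=l σ[m]=r (λ ()) (HBisim-sym B)

lemma6p1 : (k : ℕ) (σ τ : Wk k) → proj₁ σ ≢ proj₁ τ → length (proj₁ σ) ≡ length (proj₁ τ) →
    (𝓜 k ⊢ σ ∼[ k ∸ length (proj₁ σ) ] τ) × ¬ (𝓜 k ⊢ σ ∼[ k ∸ length (proj₁ σ) + 1 ] τ)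
lemma6p1 k σ τ σ≢τ e =
  equalDepth⇒bisimilar k σ τ e ,
  λ B → distinct⇒¬bisimilar k (k ∸ depth k σ) σ τ σ≢τ e (m+[n∸m]≡n (proj₂ σ))
          (subst (λ h → 𝓜 k ⊢ σ ∼[ h ] τ) (+-comm (k ∸ depth k σ) 1) B)
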